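{- The sequent calculi $\mathbf{G3iM^w}$ and $\mathbf{G4iM}$ are equivalent, i.e., a sequent is derivable in $\mathbf{G3iM^w}$ if and only if it is derivable in $\mathbf{G4iM}$.
   Context: Formulas are built from atoms, $\bot$, $\wedge,\vee,\to$ and $\Box$. Sequents are $\Gamma\Rightarrow\Delta$ with $\Gamma,\Delta$ finite multisets of formulas, $\Delta$ containing at most one formula. $\mathbf{G3iM^w}$ has axioms $\Gamma,p\Rightarrow p$ ($p$ atom), $\Gamma,\bot\Rightarrow\phi$ and rules: $L\wedge$ (from $\Gamma,\phi,\psi\Rightarrow\theta$ infer $\Gamma,\phi\wedge\psi\Rightarrow\theta$), $R\wedge$ (from $\Gamma\Rightarrow\phi$, $\Gamma\Rightarrow\psi$ infer $\Gamma\Rightarrow\phi\wedge\psi$), $L\vee$ (from $\Gamma,\phi\Rightarrow\theta$, $\Gamma,\psi\Rightarrow\theta$ infer $\Gamma,\phi\vee\psi\Rightarrow\theta$), $R\vee$ (from $\Gamma\Rightarrow\phi_i$ infer $\Gamma\Rightarrow\phi_0\vee\phi_1$, $i=0,1$), $L{\to}$ (from $\Gamma,\phi\to\psi\Rightarrow\phi$ and $\Gamma,\psi\Rightarrow\theta$ infer $\Gamma,\phi\to\psi\Rightarrow\theta$), $R{\to}$ (from $\Gamma,\phi\Rightarrow\psi$ infer $\Gamma\Rightarrow\phi\to\psi$), $M^{seq}_\Box$ (from $\phi\Rightarrow\psi$ infer $\Gamma,\Box\phi\Rightarrow\Box\psi$). $\mathbf{G4iM}$ ($\Delta$ a multiset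 with at most one formula) has axioms $\Gamma,p\Rightarrow p$ ($p$ atom) and $\Gamma,\bot\Rightarrow\Delta$, and rules: $L\wedge$ (from $\Gamma,\phi,\psi\Rightarrow\Delta$ infer $\Gamma,\phi\wedge\psi\Rightarrow\Delta$); $R\wedge$; $L\vee$ (from $\Gamma,\phi\Rightarrow\Delta$, $\Gamma,\psi\Rightarrow\Delta$ infer $\Gamma,\phi\vee\psi\Rightarrow\Delta$); $R\vee_i$; $Lp{\to}$ (from $\Gamma,p,\psi\Rightarrow\Delta$ infer $\Gamma,p,p\to\psi\Rightarrow\Delta$, $p$ atom); $L\wedge{\to}$ (from $\Gamma,\phi_1\to(\phi_2\to\psi)\Rightarrow\Delta$ infer $\Gamma,(\phi_1\wedge\phi_2)\to\psi\Rightarrow\Delta$); $L\vee{\to}$ (from $\Gamma,\phi_1\to\psi,\phi_2\to\psi\Rightarrow\Delta$ infer $\Gamma,(\phi_1\vee\phi_2)\to\psi\Rightarrow\Delta$); $R{\to}$; $L{\to}{\to}$ (from $\Gamma,\phi_2\to\psi\Rightarrow\phi_1\to\phi_2$ and $\Gamma,\psi\Rightarrow\Delta$ infer $\Gamma,(\phi_1\to\phi_2)\to\psi\Rightarrow\Delta$); $Lw$ (from $\Gamma\Rightarrow\Delta$ infer $\Gamma,\phi\Rightarrow\Delta$); $Rw$ (from $\Gamma\Rightarrow$ infer $\Gamma\Rightarrow\phi$); $M$ (from $\phi\Rightarrow\psi$ infer $\Box\phi\Rightarrow\Box\psi$); $LM{\to}$ (from $\phi\Rightarrow\psi$ and $\Gamma,\Box\phi,\theta\Rightarrow\Delta$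 infer $\Gamma,\Box\phi,\Box\psi\to\theta\Rightarrow\Delta$). -}

module Defs where

open import Data.Nat using (ℕ)
open import Data.List using (List; []; _∷_)
open import Data.Maybe using (Maybe; just; nothing)
open import Data.List.Relation.Binary.Permutation.Propositional using (_↭_)

data Fm : Set where
  atom : ℕ → Fm
  ⊥'   : Fm
  _∧'_ : Fm → Fm → Fm
  _∨'_ : Fm → Fm → Fm
  _⇒'_ : Fm → Fm → Fm
  □_   : Fm → Fm

infixr 6 _∧'_
infixr 5 _∨'_
infixr 4 _⇒'_

-- Antecedents are finite multisets, represented by lists; a multiset
-- "Γ, φ" is any list that is a permutation of φ ∷ Γ.

-- G3iM^w : sequents Γ ⇒ θ with exactly one succedent formula
-- (every rule and axiom of G3iM^w has a formula on the right).
data G3 : List Fm → Fm → Set where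
  ax   : ∀ {Δ Γ p} → Δ ↭ atom p ∷ Γ → G3 Δ (atom p)
  ax⊥  : ∀ {Δ Γ φ} → Δ ↭ ⊥' ∷ Γ → G3 Δ φ
  L∧   : ∀ {Δ Γ φ ψ θ} → Δ ↭ (φ ∧' ψ) ∷ Γ →
         G3 (φ ∷ ψ ∷ Γ) θ → G3 Δ θ
  R∧   : ∀ {Γ φ ψ} → G3 Γ φ → G3 Γ ψ → G3 Γ (φ ∧' ψ)
  L∨   : ∀ {Δ Γ φ ψ θ} → Δ ↭ (φ ∨' ψ) ∷ Γ →
         G3 (φ ∷ Γ) θ → G3 (ψ ∷ Γ) θ → G3 Δ θ
  R∨₀  : ∀ {Γ φ ψ} → G3 Γ φ → G3 Γ (φ ∨' ψ)
  R∨₁  : ∀ {Γ φ ψ} → G3 Γ ψ → G3 Γ (φ ∨' ψ)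
  L→   : ∀ {Δ Γ φ ψ θ} → Δ ↭ (φ ⇒' ψ) ∷ Γ →
         G3 ((φ ⇒' ψ) ∷ Γ) φ → G3 (ψ ∷ Γ) θ → G3 Δ θ
  R→   : ∀ {Γ φ ψ} → G3 (φ ∷ Γ) ψ → G3 Γ (φ ⇒' ψ)
  M□   : ∀ {Δ Γ φ ψ} → Δ ↭ (□ φ) ∷ Γ →
         G3 (φ ∷ []) ψ → G3 Δ (□ ψ)

data G4 : List Fm → Maybe Fm → Set where
  ax    : ∀ {Δ Γ p} → Δ ↭ atom p ∷ Γ → G4 Δ (just (atom p))
  ax⊥   : ∀ {Δ Γ χ} → Δ ↭ ⊥' ∷ Γ → G4 Δ χ
  L∧    : ∀ {Δ Γ φ ψ χ} → Δ ↭ (φ ∧' ψ) ∷ Γ →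
          G4 (φ ∷ ψ ∷ Γ) χ → G4 Δ χ
  R∧    : ∀ {Γ φ ψ} → G4 Γ (just φ) → G4 Γ (just ψ) → G4 Γ (just (φ ∧' ψ))
  L∨    : ∀ {Δ Γ φ ψ χ} → Δ ↭ (φ ∨' ψ) ∷ Γ →
          G4 (φ ∷ Γ) χ → G4 (ψ ∷ Γ) χ → G4 Δ χ
  R∨₀   : ∀ {Γ φ ψ} → G4 Γ (just φ) → G4 Γ (just (φ ∨' ψ))
  R∨₁   : ∀ {Γ φ ψ} → G4 Γ (just ψ) → G4 Γ (just (φ ∨' ψ))
  Lp→   : ∀ {Δ Γ p ψ χ} → Δ ↭ atom p ∷ (atom p ⇒' ψ) ∷ Γ →
          G4 (atom p ∷ ψ ∷ Γ) χ → G4 Δ χ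
  L∧→   : ∀ {Δ Γ φ₁ φ₂ ψ χ} → Δ ↭ ((φ₁ ∧' φ₂) ⇒' ψ) ∷ Γ →
          G4 ((φ₁ ⇒' (φ₂ ⇒' ψ)) ∷ Γ) χ → G4 Δ χ
  L∨→   : ∀ {Δ Γ φ₁ φ₂ ψ χ} → Δ ↭ ((φ₁ ∨' φ₂) ⇒' ψ) ∷ Γ →
          G4 ((φ₁ ⇒' ψ) ∷ (φ₂ ⇒' ψ) ∷ Γ) χ → G4 Δ χ
  R→    : ∀ {Γ φ ψ} → G4 (φ ∷ Γ) (just ψ) → G4 Γ (just (φ ⇒' ψ))
  L→→   : ∀ {Δ Γ φ₁ φ₂ ψ χ} → Δ ↭ ((φ₁ ⇒' φ₂) ⇒' ψ) ∷ Γ →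
          G4 ((φ₂ ⇒' ψ) ∷ Γ) (just (φ₁ ⇒' φ₂)) → G4 (ψ ∷ Γ) χ → G4 Δ χ
  Lw    : ∀ {Δ Γ φ χ} → Δ ↭ φ ∷ Γ → G4 Γ χ → G4 Δ χ
  Rw    : ∀ {Γ φ} → G4 Γ nothing → G4 Γ (just φ)
  M     : ∀ {Δ φ ψ} → Δ ↭ (□ φ) ∷ [] →
          G4 (φ ∷ []) (just ψ) → G4 Δ (just (□ ψ))
  LM→   : ∀ {Δ Γ φ ψ θ χ} → Δ ↭ (□ φ) ∷ ((□ ψ) ⇒' θ) ∷ Γ →
          G4 (φ ∷ []) (just ψ) → G4 ((□ φ) ∷ θ ∷ Γ) χ → G4 Δ χ

-- From G4iM to G3iM^w: cut is admissible in G3iM^w, and with cut every G4iM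
-- rule is derivable there.
--
-- From G3iM^w to G4iM: recursion on a measure of the end-sequent. While the
-- antecedent contains a formula with an invertible G4iM left rule, apply that
-- rule, the premise being G3iM^w-derivable by inversion. Otherwise follow the
-- last G3iM^w rule; for a final L→ on X ⇒ B, the left premise ⊢ X cannot end in
-- an axiom or a rule for ∧ or ∨, so it ends in R→ (giving L→→), in M□
-- (giving LM→), or in an L→ on another implication, which is permuted below.

module Submission where

open import Data.Empty using (⊥; ⊥-elim)
open import Data.List using (List; []; _∷_; _++_; [_]; map)
open import Data.List.Properties using (map-++)
open import Data.List.Membership.Propositional using (_∈_; lose; find)
open import Data.List.Membership.Propositional.Properties using (∈-∃++)
open import Data.List.Relation.Binary.Permutation.Propositional
  using (_↭_; refl; prep; swap; trans; ↭-sym)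
open import Data.List.Relation.Binary.Permutation.Propositional.Properties
  using (∈-resp-↭; drop-∷; shift; ++⁺ˡ; ++-identityʳ; map⁺)
open import Data.List.Relation.Unary.Any using (Any; here; there; any?)
open import Data.Maybe using (just; fromMaybe)
open import Data.Nat using (ℕ; suc; _+_; _^_; _<_; _≤_; s≤s; z≤n)
open import Data.Nat.ListAction using (sum)
open import Data.Nat.ListAction.Properties using (sum-++; sum-↭)
open import Data.Nat.Properties
  using (≤-reflexive; <-≤-trans; ≤-<-trans; m≤m+n; m≤n+m; m<m+n; n<1+n; m<n⇒m<1+n;
         +-suc; +-assoc; +-identityʳ; +-monoˡ-≤; +-monoˡ-<; +-mono-≤-<; +-mono-<;
         ^-monoʳ-≤; ^-monoʳ-<; m^n>0)
  renaming (_≟_ to _≟ℕ_)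
open import Data.Product using (_×_; _,_; ∃; proj₂)
open import Data.Sum using (_⊎_; inj₁; inj₂)
open import Data.Unit using (⊤; tt)
open import Relation.Nullary using (¬_; Dec; yes; no)
open import Relation.Nullary.Decidable using (map′)
open import Relation.Binary.PropositionalEquality
  using (_≡_; _≢_; refl; cong; sym; subst; subst₂) renaming (trans to ≡-trans)

open import Defs

module _ {a} {A : Set a} where

  exchange : ∀ {x y : A} {xs} → x ∷ y ∷ xs ↭ y ∷ x ∷ xs
  exchange = swap _ _ refl

  ∈⇒↭ : ∀ {x : A} {xs} → x ∈ xs → ∃ λ ys → xs ↭ x ∷ ys
  ∈⇒↭ x∈xs with ys , zs , refl ← ∈-∃++ x∈xs = ys ++ zs , shift _ ys zs

  ↭⇒∈ : ∀ {x : A} {xs ys} → xs ↭ x ∷ ys → x ∈ xs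
  ↭⇒∈ p = ∈-resp-↭ (↭-sym p) (here refl)

  ∷-↭-∷-inv : ∀ {x y : A} {xs ys} → x ∷ xs ↭ y ∷ ys →
              (x ≡ y × xs ↭ ys) ⊎ ∃ λ zs → ys ↭ x ∷ zs × xs ↭ y ∷ zs
  ∷-↭-∷-inv {y = y} p with ∈-resp-↭ p (here refl)
  ... | here refl = inj₁ (refl , drop-∷ p)
  ... | there x∈ys with zs , q ← ∈⇒↭ x∈ys =
    inj₂ (zs , q , drop-∷ (trans p (trans (prep y q) exchange)))

  ++-↭-∷ : ∀ zs {x : A} {xs ys} → xs ↭ x ∷ ys → zs ++ xs ↭ x ∷ zs ++ ys
  ++-↭-∷ zs {x} {ys = ys} p = trans (++⁺ˡ zs p) (shift x zs ys)

G3-↭ : ∀ {Δ Δ' C} → G3 Δ C → Δ ↭ Δ' → G3 Δ' C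
G3-↭ (ax π)     σ = ax (trans (↭-sym σ) π)
G3-↭ (ax⊥ π)    σ = ax⊥ (trans (↭-sym σ) π)
G3-↭ (L∧ π d)   σ = L∧ (trans (↭-sym σ) π) d
G3-↭ (R∧ d e)   σ = R∧ (G3-↭ d σ) (G3-↭ e σ)
G3-↭ (L∨ π d e) σ = L∨ (trans (↭-sym σ) π) d e
G3-↭ (R∨₀ d)    σ = R∨₀ (G3-↭ d σ)
G3-↭ (R∨₁ d)    σ = R∨₁ (G3-↭ d σ)
G3-↭ (L→ π d e) σ = L→ (trans (↭-sym σ) π) d e
G3-↭ (R→ d)     σ = R→ (G3-↭ d (prep _ σ))
G3-↭ (M□ π d)   σ = M□ (trans (↭-sym σ) π) d

G3-weaken : ∀ {X Δ C} → G3 Δ C → G3 (X ∷ Δ) C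
G3-weaken {X} (ax π)     = ax (trans (prep X π) exchange)
G3-weaken {X} (ax⊥ π)    = ax⊥ (trans (prep X π) exchange)
G3-weaken {X} (L∧ π d)   =
  L∧ (trans (prep X π) exchange) (G3-↭ (G3-weaken {X} d) (trans exchange (prep _ exchange)))
G3-weaken     (R∧ d e)   = R∧ (G3-weaken d) (G3-weaken e)
G3-weaken {X} (L∨ π d e) =
  L∨ (trans (prep X π) exchange) (G3-↭ (G3-weaken {X} d) exchange) (G3-↭ (G3-weaken {X} e) exchange)
G3-weaken     (R∨₀ d)    = R∨₀ (G3-weaken d)
G3-weaken     (R∨₁ d)    = R∨₁ (G3-weaken d)
G3-weaken {X} (L→ π d e) =
  L→ (trans (prep X π) exchange) (G3-↭ (G3-weaken {X} d) exchange) (G3-↭ (G3-weaken {X} e) exchange)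
G3-weaken {X} (R→ d)     = R→ (G3-↭ (G3-weaken {X} d) exchange)
G3-weaken {X} (M□ π d)   = M□ (trans (prep X π) exchange) d

G3-id : ∀ A Δ → G3 (A ∷ Δ) A
G3-id (atom p) Δ = ax refl
G3-id ⊥'       Δ = ax⊥ refl
G3-id (a ∧' b) Δ = L∧ refl (R∧ (G3-id a (b ∷ Δ)) (G3-↭ (G3-id b (a ∷ Δ)) exchange))
G3-id (a ∨' b) Δ = L∨ refl (R∨₀ (G3-id a Δ)) (R∨₁ (G3-id b Δ))
G3-id (a ⇒' b) Δ =
  R→ (L→ exchange (G3-↭ (G3-id a ((a ⇒' b) ∷ Δ)) exchange) (G3-id b (a ∷ Δ)))
G3-id (□ a)    Δ = M□ refl (G3-id a [])

G3-∈ : ∀ {A Δ} → A ∈ Δ → G3 Δ A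
G3-∈ {A} A∈Δ with Γ , π ← ∈⇒↭ A∈Δ = G3-↭ (G3-id A Γ) (↭-sym π)

-- A derivation of A ∷ Δ ⇒ C becomes one of Ys ++ Δ ⇒ C once the rules with
-- this occurrence of A principal are dealt with; Side Δ is an invariant of
-- the rest of the context that has to survive the left rules passed on the way.
record LeftElim (A : Fm) (Ys : List Fm) : Set₁ where
  field
    Side    : List Fm → Set
    Side-↭  : ∀ {Δ Δ'} → Δ ↭ Δ' → Side Δ → Side Δ'
    Side-∷  : ∀ {X Δ} → Side Δ → Side (X ∷ Δ)
    Side-∧  : ∀ {φ ψ Δ} → Side ((φ ∧' ψ) ∷ Δ) → Side (φ ∷ ψ ∷ Δ)
    Side-∨ˡ : ∀ {φ ψ Δ} → Side ((φ ∨' ψ) ∷ Δ) → Side (φ ∷ Δ)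
    Side-∨ʳ : ∀ {φ ψ Δ} → Side ((φ ∨' ψ) ∷ Δ) → Side (ψ ∷ Δ)
    Side-⇒  : ∀ {φ ψ Δ} → Side ((φ ⇒' ψ) ∷ Δ) → Side (ψ ∷ Δ)
    atomic  : ∀ {p Δ} → A ≡ atom p → Side Δ → G3 (Ys ++ Δ) (atom p)
    absurd  : ∀ {Δ C} → A ≡ ⊥' → Side Δ → G3 (Ys ++ Δ) C
    conj    : ∀ {φ ψ Δ C} → A ≡ (φ ∧' ψ) → G3 (φ ∷ ψ ∷ Δ) C → Side Δ → G3 (Ys ++ Δ) C
    disj    : ∀ {φ ψ Δ C} → A ≡ (φ ∨' ψ) → G3 (φ ∷ Δ) C → G3 (ψ ∷ Δ) C → Side Δ → G3 (Ys ++ Δ) C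
    impl    : ∀ {φ ψ Δ C} → A ≡ (φ ⇒' ψ) → G3 (Ys ++ Δ) φ → G3 (ψ ∷ Δ) C → Side Δ → G3 (Ys ++ Δ) C
    box     : ∀ {φ ψ Δ} → A ≡ □ φ → G3 (φ ∷ []) ψ → Side Δ → G3 (Ys ++ Δ) (□ ψ)

module _ {A Ys} (E : LeftElim A Ys) where
  open LeftElim E

  eliminate : ∀ {Δ' Δ C} → G3 Δ' C → Δ' ↭ A ∷ Δ → Side Δ → G3 (Ys ++ Δ) C
  eliminate (ax π) ρ s with ∷-↭-∷-inv (trans (↭-sym ρ) π)
  ... | inj₁ (eq , _)        = atomic eq s
  ... | inj₂ (_ , _ , σ)     = ax (++-↭-∷ Ys σ)
  eliminate (ax⊥ π) ρ s with ∷-↭-∷-inv (trans (↭-sym ρ) π)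
  ... | inj₁ (eq , _)        = absurd eq s
  ... | inj₂ (_ , _ , σ)     = ax⊥ (++-↭-∷ Ys σ)
  eliminate (L∧ {φ = φ} {ψ} π d) ρ s with ∷-↭-∷-inv (trans (↭-sym ρ) π)
  ... | inj₁ (refl , σ)      = conj refl (G3-↭ d (prep φ (prep ψ (↭-sym σ)))) s
  ... | inj₂ (_ , σ₁ , σ₂)   =
    L∧ (++-↭-∷ Ys σ₂)
       (G3-↭ (eliminate d (trans (prep φ (prep ψ σ₁)) (trans (prep φ exchange) exchange))
                          (Side-∧ (Side-↭ σ₂ s)))
             (trans (++-↭-∷ Ys refl) (prep φ (++-↭-∷ Ys refl))))
  eliminate (L∨ {φ = φ} {ψ} π d e) ρ s with ∷-↭-∷-inv (trans (↭-sym ρ) π)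
  ... | inj₁ (refl , σ)      = disj refl (G3-↭ d (prep φ (↭-sym σ))) (G3-↭ e (prep ψ (↭-sym σ))) s
  ... | inj₂ (_ , σ₁ , σ₂)   =
    L∨ (++-↭-∷ Ys σ₂)
       (G3-↭ (eliminate d (trans (prep φ σ₁) exchange) (Side-∨ˡ (Side-↭ σ₂ s))) (++-↭-∷ Ys refl))
       (G3-↭ (eliminate e (trans (prep ψ σ₁) exchange) (Side-∨ʳ (Side-↭ σ₂ s))) (++-↭-∷ Ys refl))
  eliminate (L→ {ψ = ψ} π d e) ρ s with ∷-↭-∷-inv (trans (↭-sym ρ) π)
  ... | inj₁ (refl , σ)      =
    impl refl (eliminate d (trans (↭-sym π) ρ) s) (G3-↭ e (prep ψ (↭-sym σ))) s
  ... | inj₂ (_ , σ₁ , σ₂)   =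
    L→ (++-↭-∷ Ys σ₂)
       (G3-↭ (eliminate d (trans (↭-sym π) ρ) s) (++-↭-∷ Ys σ₂))
       (G3-↭ (eliminate e (trans (prep ψ σ₁) exchange) (Side-⇒ (Side-↭ σ₂ s))) (++-↭-∷ Ys refl))
  eliminate (R∧ d e) ρ s     = R∧ (eliminate d ρ s) (eliminate e ρ s)
  eliminate (R∨₀ d) ρ s      = R∨₀ (eliminate d ρ s)
  eliminate (R∨₁ d) ρ s      = R∨₁ (eliminate d ρ s)
  eliminate (R→ {φ = φ} d) ρ s =
    R→ (G3-↭ (eliminate d (trans (prep φ ρ) exchange) (Side-∷ s)) (++-↭-∷ Ys refl))
  eliminate (M□ π d) ρ s with ∷-↭-∷-inv (trans (↭-sym ρ) π)
  ... | inj₁ (eq , _)        = box eq d s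
  ... | inj₂ (_ , _ , σ)     = M□ (++-↭-∷ Ys σ) d

sideless : ∀ A Ys →
  (∀ {φ ψ Δ C} → A ≡ (φ ∧' ψ) → G3 (φ ∷ ψ ∷ Δ) C → G3 (Ys ++ Δ) C) →
  (∀ {φ ψ Δ C} → A ≡ (φ ∨' ψ) → G3 (φ ∷ Δ) C → G3 (ψ ∷ Δ) C → G3 (Ys ++ Δ) C) →
  (∀ {φ ψ Δ C} → A ≡ (φ ⇒' ψ) → G3 (Ys ++ Δ) φ → G3 (ψ ∷ Δ) C → G3 (Ys ++ Δ) C) →
  (∀ {p} → A ≢ atom p) → A ≢ ⊥' → (∀ {φ} → A ≢ □ φ) → LeftElim A Ys
sideless A Ys conj disj impl ¬atom ¬⊥ ¬□ = record
  { Side = λ _ → ⊤ ; Side-↭ = _ ; Side-∷ = _ ; Side-∧ = _ ; Side-∨ˡ = _ ; Side-∨ʳ = _ ; Side-⇒ = _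
  ; atomic = λ eq _ → ⊥-elim (¬atom eq) ; absurd = λ eq _ → ⊥-elim (¬⊥ eq)
  ; conj = λ eq d _ → conj eq d ; disj = λ eq d e _ → disj eq d e ; impl = λ eq d e _ → impl eq d e
  ; box = λ eq _ _ → ⊥-elim (¬□ eq) }

∧-inv : ∀ {a b Δ C} → G3 ((a ∧' b) ∷ Δ) C → G3 (a ∷ b ∷ Δ) C
∧-inv {a} {b} d =
  eliminate (sideless (a ∧' b) (a ∷ b ∷ []) (λ { refl d → d }) (λ ()) (λ ()) (λ ()) (λ ()) (λ ())) d refl tt

∨-invˡ : ∀ {a b Δ C} → G3 ((a ∨' b) ∷ Δ) C → G3 (a ∷ Δ) C
∨-invˡ {a} {b} d =
  eliminate (sideless (a ∨' b) [ a ] (λ ()) (λ { refl d _ → d }) (λ ()) (λ ()) (λ ()) (λ ())) d refl tt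

∨-invʳ : ∀ {a b Δ C} → G3 ((a ∨' b) ∷ Δ) C → G3 (b ∷ Δ) C
∨-invʳ {a} {b} d =
  eliminate (sideless (a ∨' b) [ b ] (λ ()) (λ { refl _ e → e }) (λ ()) (λ ()) (λ ()) (λ ())) d refl tt

⇒-invʳ : ∀ {a b Δ C} → G3 ((a ⇒' b) ∷ Δ) C → G3 (b ∷ Δ) C
⇒-invʳ {a} {b} d =
  eliminate (sideless (a ⇒' b) [ b ] (λ ()) (λ ()) (λ { refl _ e → e }) (λ ()) (λ ()) (λ ())) d refl tt

atom-contraction : ∀ p → LeftElim (atom p) []
atom-contraction p = record
  { Side = atom p ∈_ ; Side-↭ = ∈-resp-↭ ; Side-∷ = there
  ; Side-∧ = λ { (there m) → there (there m) } ; Side-∨ˡ = λ { (there m) → there m }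
  ; Side-∨ʳ = λ { (there m) → there m } ; Side-⇒ = λ { (there m) → there m }
  ; atomic = λ { refl m → ax (proj₂ (∈⇒↭ m)) }
  ; absurd = λ () ; conj = λ () ; disj = λ () ; impl = λ () ; box = λ () }

contract-atom : ∀ {p Δ C} → G3 (atom p ∷ Δ) C → atom p ∈ Δ → G3 Δ C
contract-atom {p} d = eliminate (atom-contraction p) d refl

Cut : Fm → Set
Cut A = ∀ {Γ C} → G3 Γ A → G3 (A ∷ Γ) C → G3 Γ C

□-cutting : ∀ {φ ψ} → G3 [ φ ] ψ → Cut ψ → LeftElim (□ ψ) []
□-cutting {φ} φ⊢ψ cut-ψ = record
  { Side = □ φ ∈_ ; Side-↭ = ∈-resp-↭ ; Side-∷ = there
  ; Side-∧ = λ { (there m) → there (there m) } ; Side-∨ˡ = λ { (there m) → there m }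
  ; Side-∨ʳ = λ { (there m) → there m } ; Side-⇒ = λ { (there m) → there m }
  ; box = λ { refl ψ⊢χ m → M□ (proj₂ (∈⇒↭ m)) (cut-ψ φ⊢ψ (G3-↭ (G3-weaken ψ⊢χ) exchange)) }
  ; atomic = λ () ; absurd = λ () ; conj = λ () ; disj = λ () ; impl = λ () }

-- The side condition is the premise a ∷ Δ ⇒ b of the R→ that introduced a ⇒' b.
⇒-cutting : ∀ {a b} → Cut a → Cut b → LeftElim (a ⇒' b) []
⇒-cutting {a} {b} cut-a cut-b = record
  { Side = λ Δ → G3 (a ∷ Δ) b ; Side-↭ = λ σ d → G3-↭ d (prep a σ)
  ; Side-∷ = λ d → G3-↭ (G3-weaken d) exchange
  ; Side-∧ = λ d → G3-↭ (∧-inv (G3-↭ d exchange)) (trans (prep _ exchange) exchange)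
  ; Side-∨ˡ = λ d → G3-↭ (∨-invˡ (G3-↭ d exchange)) exchange
  ; Side-∨ʳ = λ d → G3-↭ (∨-invʳ (G3-↭ d exchange)) exchange
  ; Side-⇒ = λ d → G3-↭ (⇒-invʳ (G3-↭ d exchange)) exchange
  ; impl = λ { refl ⊢a b⊢ a⊢b → cut-b (cut-a ⊢a a⊢b) b⊢ }
  ; atomic = λ () ; absurd = λ () ; conj = λ () ; disj = λ () ; box = λ () }

cut : ∀ A → Cut A
cut A (ax π)     r = contract-atom r (↭⇒∈ π)
cut A (ax⊥ π)    r = ax⊥ π
cut A (L∧ π d)   r =
  L∧ π (cut A d (G3-↭ (∧-inv (G3-↭ r (trans (prep A π) exchange))) (trans (prep _ exchange) exchange)))
cut A (L∨ π d e) r =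
  L∨ π (cut A d (G3-↭ (∨-invˡ (G3-↭ r (trans (prep A π) exchange))) exchange))
       (cut A e (G3-↭ (∨-invʳ (G3-↭ r (trans (prep A π) exchange))) exchange))
cut A (L→ π d e) r = L→ π d (cut A e (G3-↭ (⇒-invʳ (G3-↭ r (trans (prep A π) exchange))) exchange))
cut (a ∧' b) (R∧ d e) r = cut a d (cut b (G3-weaken e) (G3-↭ (∧-inv r) exchange))
cut (a ∨' b) (R∨₀ d)  r = cut a d (∨-invˡ r)
cut (a ∨' b) (R∨₁ d)  r = cut b d (∨-invʳ r)
cut (a ⇒' b) (R→ d)   r = eliminate (⇒-cutting (cut a) (cut b)) r refl d
cut (□ ψ)    (M□ π d) r = eliminate (□-cutting d (cut ψ)) r refl (↭⇒∈ π)

replace-hyp : ∀ {P Q Γ C} → G3 (P ∷ Γ) Q → G3 (Q ∷ Γ) C → G3 (P ∷ Γ) C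
replace-hyp {P} P⊢Q d = cut _ P⊢Q (G3-↭ (G3-weaken {P} d) exchange)

L→-∈ : ∀ {X B Γ C} → (X ⇒' B) ∈ Γ → G3 Γ X → G3 (B ∷ Γ) C → G3 Γ C
L→-∈ {X} {B} m ⊢X B⊢ with Γ₀ , π ← ∈⇒↭ m = cut B (L→ π (G3-↭ ⊢X π) (G3-id B Γ₀)) B⊢

∧⇒-curry : ∀ {a b c Δ} → G3 (((a ∧' b) ⇒' c) ∷ Δ) (a ⇒' b ⇒' c)
∧⇒-curry {c = c} =
  R→ (R→ (L→-∈ (there (there (here refl))) (R∧ (G3-∈ (there (here refl))) (G3-∈ (here refl))) (G3-id c _)))

∧⇒-uncurry : ∀ {a b c Δ} → G3 ((a ⇒' b ⇒' c) ∷ Δ) ((a ∧' b) ⇒' c)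
∧⇒-uncurry {c = c} =
  R→ (L∧ refl (L→-∈ (there (there (here refl))) (G3-∈ (here refl))
                    (L→-∈ (here refl) (G3-∈ (there (there (here refl)))) (G3-id c _))))

∨⇒-splitˡ : ∀ {a b c Δ} → G3 (((a ∨' b) ⇒' c) ∷ Δ) (a ⇒' c)
∨⇒-splitˡ {c = c} = R→ (L→-∈ (there (here refl)) (R∨₀ (G3-∈ (here refl))) (G3-id c _))

∨⇒-splitʳ : ∀ {a b c Δ} → G3 (((a ∨' b) ⇒' c) ∷ Δ) (b ⇒' c)
∨⇒-splitʳ {c = c} = R→ (L→-∈ (there (here refl)) (R∨₁ (G3-∈ (here refl))) (G3-id c _))

∨⇒-join : ∀ {a b c Δ} → G3 ((a ⇒' c) ∷ (b ⇒' c) ∷ Δ) ((a ∨' b) ⇒' c)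
∨⇒-join {c = c} =
  R→ (L∨ refl (L→-∈ (there (here refl)) (G3-∈ (here refl)) (G3-id c _))
              (L→-∈ (there (there (here refl))) (G3-∈ (here refl)) (G3-id c _)))

⇒⇒-weaken : ∀ {a b c Δ} → G3 (((a ⇒' b) ⇒' c) ∷ Δ) (b ⇒' c)
⇒⇒-weaken {c = c} = R→ (L→-∈ (there (here refl)) (R→ (G3-∈ (there (here refl)))) (G3-id c _))

-- An empty succedent of G4iM may be read as any formula θ.
G4⇒G3 : ∀ {Γ χ} → G4 Γ χ → ∀ θ → G3 Γ (fromMaybe θ χ)
G4⇒G3 (ax π)      θ = ax π
G4⇒G3 (ax⊥ π)     θ = ax⊥ π
G4⇒G3 (L∧ π d)    θ = L∧ π (G4⇒G3 d θ)
G4⇒G3 (R∧ d e)    θ = R∧ (G4⇒G3 d θ) (G4⇒G3 e θ)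
G4⇒G3 (L∨ π d e)  θ = L∨ π (G4⇒G3 d θ) (G4⇒G3 e θ)
G4⇒G3 (R∨₀ d)     θ = R∨₀ (G4⇒G3 d θ)
G4⇒G3 (R∨₁ d)     θ = R∨₁ (G4⇒G3 d θ)
G4⇒G3 (Lp→ π d)   θ = L→ (trans π exchange) (ax exchange) (G3-↭ (G4⇒G3 d θ) exchange)
G4⇒G3 (L∧→ π d)   θ = G3-↭ (replace-hyp ∧⇒-curry (G4⇒G3 d θ)) (↭-sym π)
G4⇒G3 (L∨→ π d)   θ =
  G3-↭ (cut _ ∨⇒-splitʳ (G3-↭ (replace-hyp ∨⇒-splitˡ (G4⇒G3 d θ)) exchange)) (↭-sym π)
G4⇒G3 (R→ d)      θ = R→ (G4⇒G3 d θ)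
G4⇒G3 (L→→ π d e) θ = L→ π (replace-hyp ⇒⇒-weaken (G4⇒G3 d θ)) (G4⇒G3 e θ)
G4⇒G3 (Lw π d)    θ = G3-↭ (G3-weaken (G4⇒G3 d θ)) (↭-sym π)
G4⇒G3 (Rw {φ = φ} d) _ = G4⇒G3 d φ
G4⇒G3 (M π d)     θ = M□ π (G4⇒G3 d θ)
G4⇒G3 (LM→ π d e) θ = L→ (trans π exchange) (M□ exchange (G4⇒G3 d θ)) (G3-↭ (G4⇒G3 e θ) exchange)

-- ∧ weighs one more than ∨ and ⇒ so that a ⇒ c ⇒ b is lighter than (a ∧ c) ⇒ b.
weight : Fm → ℕ
weight (atom _) = 1
weight ⊥'       = 1
weight (a ∧' b) = suc (suc (weight a + weight b))
weight (a ∨' b) = suc (weight a + weight b)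
weight (a ⇒' b) = suc (weight a + weight b)
weight (□ a)    = suc (weight a)

-- Summing 3 ^ weight turns "replace a formula by at most two lighter ones"
-- into a decrease, so this sum stands in for the multiset ordering.
cost : Fm → ℕ
cost a = 3 ^ weight a

Cost : List Fm → ℕ
Cost Γ = sum (map cost Γ)

measure : List Fm × Fm → ℕ
measure (Γ , E) = Cost (E ∷ Γ)

-- Records rather than synonyms, so that the compared formulas and sequents
-- can be inferred from a proof.
infix 4 _≺_ _⊏_

record _≺_ (a c : Fm) : Set where
  constructor lighter
  field weight-< : weight a < weight c

record _⊏_ (S T : List Fm × Fm) : Set where
  constructor smaller
  field measure-< : measure S < measure T

m<1+m+n : ∀ m n → m < suc (m + n)
m<1+m+n m n = s≤s (m≤m+n m n)

n<1+m+n : ∀ m n → n < suc (m + n)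
n<1+m+n m n = s≤s (m≤n+m n m)

≺-∧ˡ : ∀ a b → a ≺ (a ∧' b)
≺-∧ˡ a b = lighter (m<n⇒m<1+n (m<1+m+n (weight a) (weight b)))

≺-∧ʳ : ∀ a b → b ≺ (a ∧' b)
≺-∧ʳ a b = lighter (m<n⇒m<1+n (n<1+m+n (weight a) (weight b)))

≺-∨ˡ : ∀ a b → a ≺ (a ∨' b)
≺-∨ˡ a b = lighter (m<1+m+n (weight a) (weight b))

≺-∨ʳ : ∀ a b → b ≺ (a ∨' b)
≺-∨ʳ a b = lighter (n<1+m+n (weight a) (weight b))

≺-⇒ˡ : ∀ a b → a ≺ (a ⇒' b)
≺-⇒ˡ a b = lighter (m<1+m+n (weight a) (weight b))

≺-⇒ʳ : ∀ a b → b ≺ (a ⇒' b)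
≺-⇒ʳ a b = lighter (n<1+m+n (weight a) (weight b))

≺-□ : ∀ a → a ≺ □ a
≺-□ a = lighter (n<1+n (weight a))

≺-∧⇒ : ∀ a c b → (a ⇒' c ⇒' b) ≺ ((a ∧' c) ⇒' b)
≺-∧⇒ a c b = lighter (s≤s (s≤s (≤-reflexive
  (≡-trans (+-suc (weight a) _) (cong suc (sym (+-assoc (weight a) (weight c) (weight b))))))))

≺-∨⇒ˡ : ∀ a c b → (a ⇒' b) ≺ ((a ∨' c) ⇒' b)
≺-∨⇒ˡ a c b = lighter (s≤s (s≤s (+-monoˡ-≤ (weight b) (m≤m+n (weight a) (weight c)))))

≺-∨⇒ʳ : ∀ a c b → (c ⇒' b) ≺ ((a ∨' c) ⇒' b)
≺-∨⇒ʳ a c b = lighter (s≤s (s≤s (+-monoˡ-≤ (weight b) (m≤n+m (weight c) (weight a)))))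

≺-⇒⇒ : ∀ a c b → (c ⇒' b) ≺ ((a ⇒' c) ⇒' b)
≺-⇒⇒ a c b = lighter (s≤s (s≤s (+-monoˡ-≤ (weight b) (m≤n+m (weight c) (weight a)))))

≺-□⇒ : ∀ a b → a ≺ (□ a ⇒' b)
≺-□⇒ a b = lighter (m<n⇒m<1+n (m<1+m+n (weight a) (weight b)))

3^-<₂ : ∀ {x y z} → x < z → y < z → 3 ^ x + 3 ^ y < 3 ^ z
3^-<₂ {z = suc z} (s≤s x≤z) (s≤s y≤z) =
  +-mono-≤-< (^-monoʳ-≤ 3 x≤z)
             (≤-<-trans (^-monoʳ-≤ 3 y≤z) (m<m+n (3 ^ z) (<-≤-trans (m^n>0 3 z) (m≤m+n (3 ^ z) 0))))

cost-< : ∀ {a c} → a ≺ c → cost a < cost c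
cost-< (lighter a<c) = ^-monoʳ-< 3 (s≤s (s≤s z≤n)) a<c

Cost-<₁ : ∀ {a c} → a ≺ c → Cost [ a ] < Cost [ c ]
Cost-<₁ a≺c = +-monoˡ-< 0 (cost-< a≺c)

Cost-<₂ : ∀ {a b c} → a ≺ c → b ≺ c → Cost (a ∷ b ∷ []) < Cost [ c ]
Cost-<₂ {a} {b} {c} (lighter a<c) (lighter b<c) =
  subst₂ _<_ (cong (cost a +_) (sym (+-identityʳ (cost b)))) (sym (+-identityʳ (cost c))) (3^-<₂ a<c b<c)

Cost-<₂₂ : ∀ {a b c d} → a ≺ c → b ≺ d → Cost (a ∷ b ∷ []) < Cost (c ∷ d ∷ [])
Cost-<₂₂ a≺c b≺d = +-mono-< (cost-< a≺c) (Cost-<₁ b≺d)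

Cost-↭ : ∀ {Γ Δ} → Γ ↭ Δ → Cost Γ ≡ Cost Δ
Cost-↭ p = sum-↭ (map⁺ cost p)

Cost-++ : ∀ Γ Δ → Cost (Γ ++ Δ) ≡ Cost Γ + Cost Δ
Cost-++ Γ Δ = ≡-trans (cong sum (map-++ cost Γ Δ)) (sum-++ (map cost Γ) (map cost Δ))

Cost-replace : ∀ {L L' Xs Ys R} → L ↭ Xs ++ R → L' ↭ Ys ++ R → Cost Ys < Cost Xs → Cost L' < Cost L
Cost-replace {Xs = Xs} {Ys} {R} p q lt =
  subst₂ _<_ (sym (≡-trans (Cost-↭ q) (Cost-++ Ys R))) (sym (≡-trans (Cost-↭ p) (Cost-++ Xs R)))
         (+-monoˡ-< (Cost R) lt)

Cost-<-sublist : ∀ {L Xs Ys R} → L ↭ Xs ++ R → Cost Ys < Cost Xs → Cost Ys < Cost L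
Cost-<-sublist {Xs = Xs} {R = R} p lt =
  <-≤-trans lt (subst (Cost Xs ≤_) (sym (≡-trans (Cost-↭ p) (Cost-++ Xs R))) (m≤m+n (Cost Xs) (Cost R)))

⊏-replace : ∀ {Γ X Γ₀ E} Ys → Γ ↭ X ∷ Γ₀ → Cost Ys < Cost [ X ] → (Ys ++ Γ₀ , E) ⊏ (Γ , E)
⊏-replace {X = X} {Γ₀} {E} Ys π lt =
  smaller (Cost-replace {Xs = [ X ]} {Ys} {E ∷ Γ₀} (trans (prep E π) exchange) (↭-sym (shift E Ys Γ₀)) lt)

⊏-succedent : ∀ {Γ a c} → a ≺ c → (Γ , a) ⊏ (Γ , c)
⊏-succedent {Γ} a≺c = smaller (+-monoˡ-< (Cost Γ) (cost-< a≺c))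

⊏-R→ : ∀ {Γ} a b → (a ∷ Γ , b) ⊏ (Γ , a ⇒' b)
⊏-R→ {Γ} a b =
  smaller (Cost-replace {Xs = [ a ⇒' b ]} {b ∷ a ∷ []} {Γ} refl refl (Cost-<₂ (≺-⇒ʳ a b) (≺-⇒ˡ a b)))

⊏-M : ∀ {Γ Γ₀ φ ψ} → Γ ↭ □ φ ∷ Γ₀ → ([ φ ] , ψ) ⊏ (Γ , □ ψ)
⊏-M {Γ₀ = Γ₀} {φ} {ψ} π =
  smaller (Cost-<-sublist {Xs = □ ψ ∷ □ φ ∷ []} {ψ ∷ φ ∷ []} {Γ₀} (prep (□ ψ) π) (Cost-<₂₂ (≺-□ ψ) (≺-□ φ)))

⊏-LM→ : ∀ {Γ Γ₀ E φ ψ B} → Γ ↭ (□ ψ ⇒' B) ∷ □ φ ∷ Γ₀ → ([ φ ] , ψ) ⊏ (Γ , E)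
⊏-LM→ {Γ₀ = Γ₀} {E} {φ} {ψ} {B} π =
  smaller (Cost-<-sublist {Xs = Xs} {ψ ∷ φ ∷ []} {E ∷ Γ₀} (trans (prep E π) (↭-sym (shift E Xs Γ₀)))
                          (Cost-<₂₂ (≺-□⇒ ψ B) (≺-□ φ)))
  where Xs = (□ ψ ⇒' B) ∷ □ φ ∷ []

⊏-L→→ : ∀ {Γ Γ₀ E a c B} → Γ ↭ ((a ⇒' c) ⇒' B) ∷ Γ₀ → ((c ⇒' B) ∷ Γ₀ , a ⇒' c) ⊏ (Γ , E)
⊏-L→→ {Γ₀ = Γ₀} {E} {a} {c} {B} π =
  smaller (<-≤-trans (Cost-replace {Xs = [ (a ⇒' c) ⇒' B ]} {(a ⇒' c) ∷ (c ⇒' B) ∷ []} {Γ₀} π refl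
                                   (Cost-<₂ (≺-⇒ˡ (a ⇒' c) B) (≺-⇒⇒ a c B)))
                     (m≤n+m _ (cost E)))

G4-↭ : ∀ {Δ Δ' χ} → G4 Δ χ → Δ ↭ Δ' → G4 Δ' χ
G4-↭ (ax π)      σ = ax (trans (↭-sym σ) π)
G4-↭ (ax⊥ π)     σ = ax⊥ (trans (↭-sym σ) π)
G4-↭ (L∧ π d)    σ = L∧ (trans (↭-sym σ) π) d
G4-↭ (R∧ d e)    σ = R∧ (G4-↭ d σ) (G4-↭ e σ)
G4-↭ (L∨ π d e)  σ = L∨ (trans (↭-sym σ) π) d e
G4-↭ (R∨₀ d)     σ = R∨₀ (G4-↭ d σ)
G4-↭ (R∨₁ d)     σ = R∨₁ (G4-↭ d σ)
G4-↭ (Lp→ π d)   σ = Lp→ (trans (↭-sym σ) π) d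
G4-↭ (L∧→ π d)   σ = L∧→ (trans (↭-sym σ) π) d
G4-↭ (L∨→ π d)   σ = L∨→ (trans (↭-sym σ) π) d
G4-↭ (R→ d)      σ = R→ (G4-↭ d (prep _ σ))
G4-↭ (L→→ π d e) σ = L→→ (trans (↭-sym σ) π) d e
G4-↭ (Lw π d)    σ = Lw (trans (↭-sym σ) π) d
G4-↭ (Rw d)      σ = Rw (G4-↭ d σ)
G4-↭ (M π d)     σ = M (trans (↭-sym σ) π) d
G4-↭ (LM→ π d e) σ = LM→ (trans (↭-sym σ) π) d e

G4-weakenʳ : ∀ {Δ χ} Θ → G4 Δ χ → G4 (Δ ++ Θ) χ
G4-weakenʳ {Δ} []      d = G4-↭ d (↭-sym (++-identityʳ Δ))
G4-weakenʳ {Δ} (X ∷ Θ) d = Lw (shift X Δ Θ) (G4-weakenʳ Θ d)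

⇒⇒-premise : ∀ {a c B Γ} → G3 (a ∷ ((a ⇒' c) ⇒' B) ∷ Γ) c → G3 ((c ⇒' B) ∷ Γ) (a ⇒' c)
⇒⇒-premise {a} {c} {B} {Γ} d =
  R→ (cut ((a ⇒' c) ⇒' B) ⊢⇒⇒ (G3-↭ (G3-weaken {c ⇒' B} d)
                                     (trans (prep _ exchange) (trans exchange (prep _ exchange)))))
  where
  ⊢⇒⇒ : G3 (a ∷ (c ⇒' B) ∷ Γ) ((a ⇒' c) ⇒' B)
  ⊢⇒⇒ = R→ (L→-∈ (there (there (here refl))) (L→-∈ (here refl) (G3-∈ (there (here refl))) (G3-∈ (here refl)))
                 (G3-id B _))

_≟atom_ : ∀ p φ → Dec (atom p ≡ φ)
p ≟atom atom q   = map′ (cong atom) (λ { refl → refl }) (p ≟ℕ q)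
p ≟atom ⊥'       = no λ ()
p ≟atom (_ ∧' _) = no λ ()
p ≟atom (_ ∨' _) = no λ ()
p ≟atom (_ ⇒' _) = no λ ()
p ≟atom (□ _)    = no λ ()

Invertible : List Fm → Fm → Set
Invertible Γ ⊥'              = ⊤
Invertible Γ (_ ∧' _)        = ⊤
Invertible Γ (_ ∨' _)        = ⊤
Invertible Γ (atom p ⇒' _)   = atom p ∈ Γ
Invertible Γ ((_ ∧' _) ⇒' _) = ⊤
Invertible Γ ((_ ∨' _) ⇒' _) = ⊤
Invertible Γ _               = ⊥

invertible? : ∀ Γ φ → Dec (Invertible Γ φ)
invertible? Γ ⊥'              = yes tt
invertible? Γ (_ ∧' _)        = yes tt
invertible? Γ (_ ∨' _)        = yes tt
invertible? Γ (atom p ⇒' _)   = any? (p ≟atom_) Γ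
invertible? Γ ((_ ∧' _) ⇒' _) = yes tt
invertible? Γ ((_ ∨' _) ⇒' _) = yes tt
invertible? Γ (atom _)        = no λ ()
invertible? Γ (⊥' ⇒' _)       = no λ ()
invertible? Γ ((_ ⇒' _) ⇒' _) = no λ ()
invertible? Γ ((□ _) ⇒' _)    = no λ ()
invertible? Γ (□ _)           = no λ ()

Irreducible : List Fm → Set
Irreducible Γ = ¬ Any (Invertible Γ) Γ

Complete : List Fm → Fm → Set
Complete Γ E = G3 Γ E → G4 Γ (just E)

module Completion {Γ E} (ih : ∀ {Γ' E'} → (Γ' , E') ⊏ (Γ , E) → Complete Γ' E') where

  replacing : ∀ {X Γ₀} Ys → Γ ↭ X ∷ Γ₀ → Cost Ys < Cost [ X ] → Complete (Ys ++ Γ₀) E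
  replacing Ys π lt = ih (⊏-replace Ys π lt)

  reduce : ∀ {φ} → G3 Γ E → φ ∈ Γ → Invertible Γ φ → G4 Γ (just E)
  reduce {⊥'} _ m _ = ax⊥ (proj₂ (∈⇒↭ m))
  reduce {a ∧' b} d m _ with Γ₀ , π ← ∈⇒↭ m =
    L∧ π (replacing (a ∷ b ∷ []) π (Cost-<₂ (≺-∧ˡ a b) (≺-∧ʳ a b)) (∧-inv (G3-↭ d π)))
  reduce {a ∨' b} d m _ with Γ₀ , π ← ∈⇒↭ m =
    L∨ π (replacing [ a ] π (Cost-<₁ (≺-∨ˡ a b)) (∨-invˡ (G3-↭ d π)))
         (replacing [ b ] π (Cost-<₁ (≺-∨ʳ a b)) (∨-invʳ (G3-↭ d π)))
  reduce {atom p ⇒' b} d m p∈Γ with ∈⇒↭ m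
  ... | Γ₀ , π with ∈-resp-↭ π p∈Γ
  ... | there p∈Γ₀ with Γ₁ , σ ← ∈⇒↭ p∈Γ₀ =
    Lp→ (trans π (trans (prep _ σ) exchange))
        (G4-↭ (replacing [ b ] π (Cost-<₁ (≺-⇒ʳ (atom p) b)) (⇒-invʳ (G3-↭ d π)))
              (trans (prep b σ) exchange))
  reduce {(a ∧' c) ⇒' b} d m _ with Γ₀ , π ← ∈⇒↭ m =
    L∧→ π (replacing [ a ⇒' c ⇒' b ] π (Cost-<₁ (≺-∧⇒ a c b)) (replace-hyp ∧⇒-uncurry (G3-↭ d π)))
  reduce {(a ∨' c) ⇒' b} d m _ with Γ₀ , π ← ∈⇒↭ m =
    L∨→ π (replacing ((a ⇒' b) ∷ (c ⇒' b) ∷ []) π (Cost-<₂ (≺-∨⇒ˡ a c b) (≺-∨⇒ʳ a c b))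
                     (cut _ ∨⇒-join (G3-↭ (G3-weaken (G3-weaken (G3-↭ d π)))
                                          (shift _ ((a ⇒' b) ∷ (c ⇒' b) ∷ []) Γ₀))))
  reduce {atom _}          _ _ ()
  reduce {□ _}             _ _ ()
  reduce {⊥' ⇒' _}         _ _ ()
  reduce {(_ ⇒' _) ⇒' _}   _ _ ()
  reduce {(□ _) ⇒' _}      _ _ ()

  module _ (irr : Irreducible Γ) where

    not-invertible : ∀ {φ} → φ ∈ Γ → ¬ Invertible Γ φ
    not-invertible m inv = irr (lose m inv)

    lastL→ : ∀ {X B Γ₀ Γ'} → Γ ↭ (X ⇒' B) ∷ Γ₀ → Γ' ↭ Γ → G3 Γ' X → G3 (B ∷ Γ₀) E → G4 Γ (just E)
    lastL→ π ρ (ax σ)     _ = ⊥-elim (not-invertible (↭⇒∈ π) (∈-resp-↭ ρ (↭⇒∈ σ)))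
    lastL→ π ρ (ax⊥ σ)    _ = ⊥-elim (not-invertible (∈-resp-↭ ρ (↭⇒∈ σ)) tt)
    lastL→ π ρ (L∧ σ _)   _ = ⊥-elim (not-invertible (∈-resp-↭ ρ (↭⇒∈ σ)) tt)
    lastL→ π ρ (L∨ σ _ _) _ = ⊥-elim (not-invertible (∈-resp-↭ ρ (↭⇒∈ σ)) tt)
    lastL→ π ρ (R∧ _ _)   _ = ⊥-elim (not-invertible (↭⇒∈ π) tt)
    lastL→ π ρ (R∨₀ _)    _ = ⊥-elim (not-invertible (↭⇒∈ π) tt)
    lastL→ π ρ (R∨₁ _)    _ = ⊥-elim (not-invertible (↭⇒∈ π) tt)
    lastL→ {B = B} π ρ (R→ {φ = a} {c} d) r =
      L→→ π (ih (⊏-L→→ π) (⇒⇒-premise (G3-↭ d (prep a (trans ρ π)))))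
            (replacing [ B ] π (Cost-<₁ (≺-⇒ʳ (a ⇒' c) B)) r)
    lastL→ {B = B} π ρ (M□ {ψ = ψ} σ d) r with ∈-resp-↭ π (∈-resp-↭ ρ (↭⇒∈ σ))
    ... | there □φ∈Γ₀ with Γ₁ , τ ← ∈⇒↭ □φ∈Γ₀ =
      LM→ (trans π (trans (prep _ τ) exchange)) (ih (⊏-LM→ (trans π (prep _ τ))) d)
          (G4-↭ (replacing [ B ] π (Cost-<₁ (≺-⇒ʳ (□ ψ) B)) r) (trans (prep B τ) exchange))
    lastL→ {B = B} π ρ (L→ {Γ = Γ₁} {Z} {C} σ d₁ d₂) r = lastL→ π' (trans (↭-sym σ) ρ) d₁ r'
      where
      π' : Γ ↭ (Z ⇒' C) ∷ Γ₁
      π' = trans (↭-sym ρ) σ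
      r' : G3 (C ∷ Γ₁) E
      r' with ∷-↭-∷-inv (trans (↭-sym π) π')
      ... | inj₁ (refl , τ)    = G3-↭ r (prep B τ)
      ... | inj₂ (_ , τ₁ , τ₂) =
        L→ (trans (prep C τ₁) exchange) (G3-↭ d₂ (trans (prep C τ₁) exchange))
           (G3-↭ (⇒-invʳ (G3-↭ r (trans (prep B τ₂) exchange))) exchange)

    irreducible : Complete Γ E
    irreducible (ax π)     = ax π
    irreducible (ax⊥ π)    = ax⊥ π
    irreducible (L∧ π _)   = ⊥-elim (not-invertible (↭⇒∈ π) tt)
    irreducible (L∨ π _ _) = ⊥-elim (not-invertible (↭⇒∈ π) tt)
    irreducible (R∧ {φ = a} {b} d e) =
      R∧ (ih (⊏-succedent (≺-∧ˡ a b)) d) (ih (⊏-succedent (≺-∧ʳ a b)) e)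
    irreducible (R∨₀ {φ = a} {b} d) = R∨₀ (ih (⊏-succedent (≺-∨ˡ a b)) d)
    irreducible (R∨₁ {φ = a} {b} d) = R∨₁ (ih (⊏-succedent (≺-∨ʳ a b)) d)
    irreducible (R→ {φ = a} {b} d)  = R→ (ih (⊏-R→ a b) d)
    irreducible (M□ π d)   = G4-↭ (G4-weakenʳ _ (M refl (ih (⊏-M π) d))) (↭-sym π)
    irreducible (L→ π d e) = lastL→ π (↭-sym π) d e

  step : Complete Γ E
  step d with any? (invertible? Γ) Γ
  ... | yes inv with _ , φ∈Γ , φ-inv ← find inv = reduce d φ∈Γ φ-inv
  ... | no irr = irreducible irr d

complete : ∀ n {Γ E} → measure (Γ , E) < n → Complete Γ E
complete (suc n) (s≤s le) = Completion.step (λ (smaller lt) → complete n (<-≤-trans lt le))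

theorem3p5 : (Γ : List Fm) (φ : Fm) →
    (G3 Γ φ → G4 Γ (just φ)) × (G4 Γ (just φ) → G3 Γ φ)
theorem3p5 Γ φ = complete (suc (measure (Γ , φ))) (n<1+n (measure (Γ , φ))) , λ d → G4⇒G3 d φ
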